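{- Let $\dot G\in\mathcal{C}_1\cup\mathcal{C}_4\cup\mathcal{C}_5$ be a connected, non-complete, $5$-regular and $1$ net-regular strongly regular signed graph with parameters $(n,5,a,b,c)$. If $(a,b)=(2,1)$, then $\dot G$ is isomorphic to the signed graph $\dot S^1_{12}$ with parameters $(12,5,2,1,-2)$, where $\dot S^1_{12}$ has vertex set $\{1,2,3,4\}\times\{1,2,3\}$, positive edges $(p,q)(p',q)$ for $p\neq p'$, negative edges $(p,q)(p,q')$ for $q\neq q'$, and no other edges.
   Context: A signed graph $\dot G=(G,\sigma)$ is a simple graph $G$ (its underlying graph) with a sign function $\sigma:E(G)\to\{+1,-1\}$; its adjacency matrix $A_{\dot G}$ has $(i,j)$ entry $\sigma(v_iv_j)$ if $v_i\sim v_j$ and $0$ otherwise. Degree is the degree in $G$; $d^\pm(v)$ are the numbers of positive/negative edges at $v$; the net-degree is $d^+(v)-d^-(v)$, and $\dot G$ is $\rho$ net-regular if all net-degrees equal $\rho$. Connected/complete refer to $G$. $\dot G$ is homogeneous if all edges have the same sign, inhomogeneous otherwise. A signed graph on $n$ vertices is strongly regular (SRSG) if it is neither homogeneous complete nor edgeless and there are $r\in\mathbb N$, $a,b,c\in\mathbb Z$ with $(A^2_{\dot G})_{ii}=r$, $(A^2_{\dot G})_{ij}=a$ for positive edges $v_iv_j$, $=b$ for negative edges, $=c$ for distinct non-adjacent $v_i,v_j$; parameters $(n,r,a,b,c)$. Inhomogeneous SRSGs are divided into classes: $\mathcal{C}_1$: $a=-b$, and either complete or non-complete with $c\neq 0$;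 $\mathcal{C}_4$: $a\neq -b$, non-complete with $c=0$; $\mathcal{C}_5$: $a\ne -b$, non-complete with $c\neq\frac{a+b}{2}$ and $c\neq 0$. Isomorphism of signed graphs means isomorphism of underlying graphs preserving signs. -}

module Defs where

open import Data.Nat using (ℕ; zero; suc)
open import Data.Integer using (ℤ; +_; -_; _+_; _*_; -1ℤ; 0ℤ; 1ℤ)
open import Data.Fin using (Fin; zero; suc; remQuot)
open import Data.Fin.Properties using (_≟_)
open import Data.Product using (Σ; _×_; _,_; proj₁; proj₂)
open import Data.Sum using (_⊎_)
open import Data.Bool using (true; false)
open import Relation.Nullary using (¬_; does)
open import Relation.Binary.PropositionalEquality using (_≡_; _≢_)
open import Function.Bundles using (_⤖_; Bijection)

data Entry : Set where
  pos neg non : Entry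

entryℤ : Entry → ℤ
entryℤ pos = 1ℤ
entryℤ neg = -1ℤ
entryℤ non = 0ℤ

record SignedGraph (n : ℕ) : Set where
  field
    adj   : Fin n → Fin n → Entry
    sym   : ∀ i j → adj i j ≡ adj j i
    loopless : ∀ i → adj i i ≡ non
open SignedGraph public

Adjacent : ∀ {n} → SignedGraph n → Fin n → Fin n → Set
Adjacent G i j = adj G i j ≢ non

∑ : ∀ n → (Fin n → ℤ) → ℤ
∑ zero    f = 0ℤ
∑ (suc n) f = f zero + ∑ n (λ i → f (suc i))

∑ℕ : ∀ n → (Fin n → ℕ) → ℕ
∑ℕ zero    f = 0
∑ℕ (suc n) f = f zero Data.Nat.+ ∑ℕ n (λ i → f (suc i))

A : ∀ {n} → SignedGraph n → Fin n → Fin n → ℤ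
A G i j = entryℤ (adj G i j)

A² : ∀ {n} → SignedGraph n → Fin n → Fin n → ℤ
A² {n} G i j = ∑ n (λ k → A G i k * A G k j)

isEdge : Entry → ℕ
isEdge non = 0
isEdge _   = 1

degree : ∀ {n} → SignedGraph n → Fin n → ℕ
degree {n} G i = ∑ℕ n (λ k → isEdge (adj G i k))

netDegree : ∀ {n} → SignedGraph n → Fin n → ℤ
netDegree {n} G i = ∑ n (λ k → A G i k)

Regular : ∀ {n} → SignedGraph n → ℕ → Set
Regular G r = ∀ i → degree G i ≡ r

NetRegular : ∀ {n} → SignedGraph n → ℤ → Set
NetRegular G ρ = ∀ i → netDegree G i ≡ ρ

data Walk {n} (G : SignedGraph n) : Fin n → Fin n → Set where
  here : ∀ {i} → Walk G i i
  step : ∀ {i j k} → Adjacent G i j → Walk G j k → Walk G i k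

Connected : ∀ {n} → SignedGraph n → Set
Connected G = ∀ i j → Walk G i j

Complete : ∀ {n} → SignedGraph n → Set
Complete G = ∀ i j → i ≢ j → Adjacent G i j

Edgeless : ∀ {n} → SignedGraph n → Set
Edgeless G = ∀ i j → adj G i j ≡ non

Homogeneous : ∀ {n} → SignedGraph n → Set
Homogeneous G = (∀ i j → adj G i j ≢ neg) ⊎ (∀ i j → adj G i j ≢ pos)

Inhomogeneous : ∀ {n} → SignedGraph n → Set
Inhomogeneous G = ¬ Homogeneous G

record IsSRSG {n} (G : SignedGraph n) (r : ℕ) (a b c : ℤ) : Set where
  field
    notHomComplete : ¬ (Homogeneous G × Complete G)
    notEdgeless    : ¬ Edgeless G
    diagonal       : ∀ i → A² G i i ≡ + r
    posEdges       : ∀ i j → adj G i j ≡ pos → A² G i j ≡ a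
    negEdges       : ∀ i j → adj G i j ≡ neg → A² G i j ≡ b
    nonAdjacent    : ∀ i j → i ≢ j → adj G i j ≡ non → A² G i j ≡ c

InC₁ : ∀ {n} → SignedGraph n → ℤ → ℤ → ℤ → Set
InC₁ G a b c = Inhomogeneous G × a ≡ - b × (Complete G ⊎ (¬ Complete G × c ≢ 0ℤ))

InC₄ : ∀ {n} → SignedGraph n → ℤ → ℤ → ℤ → Set
InC₄ G a b c = Inhomogeneous G × a ≢ - b × ¬ Complete G × c ≡ 0ℤ

-- c ≠ (a+b)/2 is written 2c ≠ a + b
InC₅ : ∀ {n} → SignedGraph n → ℤ → ℤ → ℤ → Set
InC₅ G a b c = Inhomogeneous G × a ≢ - b × ¬ Complete G × (+ 2 * c ≢ a + b) × c ≢ 0ℤ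

_≅_ : ∀ {n m} → SignedGraph n → (Fin m → Fin m → Entry) → Set
_≅_ {n} {m} G H = Σ (Fin n ⤖ Fin m) λ f →
  ∀ i j → adj G i j ≡ H (Bijection.to f i) (Bijection.to f j)

S₁₂-entry : Fin 4 × Fin 3 → Fin 4 × Fin 3 → Entry
S₁₂-entry (p , q) (p' , q') with does (p ≟ p') | does (q ≟ q')
... | false | true  = pos
... | true  | false = neg
... | _     | _     = non

S₁₂ : Fin 12 → Fin 12 → Entry
S₁₂ i j = S₁₂-entry (remQuot 3 i) (remQuot 3 j)

module Submission where

-- Weight each path v – k – u of length two by |A_vk| |A_ku| ∓ A_vk A_ku, with the minus sign when
-- u = v or u ~ v and the plus sign otherwise.  Every weight is non-negative, and counting walks of
-- length two with the SRSG parameters, regularity and net-regularity shows that the weights at v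
-- add up to r² + ρ² − (2r + (a − b)ρ + (a + b)r), which is 0 for (r, a, b, ρ) = (5, 2, 1, 1).
-- So every triangle is monochromatic and every induced path of length two changes sign: "equal or
-- joined by a positive (negative) edge" is an equivalence relation, whose classes are positive
-- 4-cliques (negative triangles) meeting in at most one vertex.  Two non-adjacent vertices then have
-- exactly −c common neighbours, at most one reached by a positive-then-negative path and at most
-- one by a negative-then-positive path.  A common neighbour exists across every positive–negative
-- pair at a vertex, so c ≠ 0, and a short argument around one vertex rules out c = −1.  Hence both
-- paths always exist, every positive clique meets every negative triangle, and the pair of classes
-- of a vertex identifies G with the 4 × 3 rook's graph S¹₁₂.

open import Defs renaming (sym to adj-sym)
open import Data.Nat as ℕ using (ℕ; zero; suc)
import Data.Nat.Properties as ℕ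
open import Data.Integer as ℤ using (ℤ; +_; -_; _+_; _-_; _*_; -1ℤ; 0ℤ; 1ℤ; _≤_; +≤+)
import Data.Integer.Properties as ℤ
open import Data.Integer.Tactic.RingSolver using (solve-∀)
open import Data.Fin as Fin using (Fin; zero; suc; punchIn; combine)
open import Data.Fin.Properties using (_≟_; punchInᵢ≢i; suc-injective; *↔×; remQuot-combine)
open import Data.Product using (∃; ∃₂; _×_; _,_; proj₁; proj₂; uncurry)
open import Data.Sum using (_⊎_; inj₁; inj₂)
open import Data.Bool using (true; false)
open import Data.Empty using (⊥; ⊥-elim)
open import Function using (_∘_; _↔_; mk↔ₛ′)
open import Function.Construct.Composition using (_↔-∘_)
open import Function.Properties.Inverse using (↔-sym; ↔⇒⤖)
open import Relation.Nullary using (¬_; Dec; yes; no; does; _×-dec_; _⊎-dec_)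
open import Relation.Nullary.Negation using (contradiction)
open import Relation.Unary using (Decidable)
open import Relation.Binary.Definitions using (DecidableEquality)
open import Relation.Binary.PropositionalEquality
open import Algebra.Properties.Semiring.Sum ℤ.+-*-semiring
  using (sum; sum-syntax; sum-cong-≗; sum-remove; sum-replicate-zero;
         ∑-distrib-+; ∑-comm; *-distribˡ-sum; *-distribʳ-sum)

∑≡sum : ∀ n (f : Fin n → ℤ) → ∑ n f ≡ sum f
∑≡sum zero    f = refl
∑≡sum (suc n) f = cong (_+_ (f zero)) (∑≡sum n (f ∘ suc))

∑ℕ≡sum : ∀ n (f : Fin n → ℕ) → + ∑ℕ n f ≡ ∑[ i < n ] (+ f i)
∑ℕ≡sum zero    f = refl
∑ℕ≡sum (suc n) f = trans (ℤ.pos-+ (f zero) _) (cong (_+_ (+ f zero)) (∑ℕ≡sum n (f ∘ suc)))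

∑-neg : ∀ {n} (f : Fin n → ℤ) → ∑[ i < n ] (- f i) ≡ - sum f
∑-neg {n} f = begin
  ∑[ i < n ] (- f i)       ≡⟨ sum-cong-≗ (sym ∘ ℤ.-1*i≡-i ∘ f) ⟩
  ∑[ i < n ] (-1ℤ * f i)   ≡⟨ *-distribˡ-sum -1ℤ f ⟨
  -1ℤ * sum f              ≡⟨ ℤ.-1*i≡-i (sum f) ⟩
  - sum f                  ∎
  where open ≡-Reasoning

∑-linear₃ : ∀ {n} (α β γ : ℤ) (f g h : Fin n → ℤ) →
            ∑[ i < n ] (α * f i + (β * g i + γ * h i)) ≡ α * sum f + (β * sum g + γ * sum h)
∑-linear₃ {n} α β γ f g h = begin
  ∑[ i < n ] (α * f i + (β * g i + γ * h i))
    ≡⟨ ∑-distrib-+ (λ i → α * f i) (λ i → β * g i + γ * h i) ⟩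
  ∑[ i < n ] (α * f i) + ∑[ i < n ] (β * g i + γ * h i)
    ≡⟨ cong (_+_ (∑[ i < n ] (α * f i))) (∑-distrib-+ (λ i → β * g i) (λ i → γ * h i)) ⟩
  ∑[ i < n ] (α * f i) + (∑[ i < n ] (β * g i) + ∑[ i < n ] (γ * h i))
    ≡⟨ cong₂ _+_ (*-distribˡ-sum α f) (cong₂ _+_ (*-distribˡ-sum β g) (*-distribˡ-sum γ h)) ⟨
  α * sum f + (β * sum g + γ * sum h) ∎
  where open ≡-Reasoning

two-step-row-sum : ∀ {n} (M : Fin n → Fin n → ℤ) {s} → (∀ v → ∑[ u < n ] M v u ≡ s) →
                   ∀ v → ∑[ u < n ] ∑[ k < n ] (M v k * M k u) ≡ s * s
two-step-row-sum {n} M {s} row v = begin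
  ∑[ u < n ] ∑[ k < n ] (M v k * M k u)   ≡⟨ ∑-comm (λ u k → M v k * M k u) ⟩
  ∑[ k < n ] ∑[ u < n ] (M v k * M k u)   ≡⟨ sum-cong-≗ (λ k → *-distribˡ-sum (M v k) (M k)) ⟨
  ∑[ k < n ] (M v k * sum (M k))          ≡⟨ sum-cong-≗ (λ k → cong (M v k *_) (row k)) ⟩
  ∑[ k < n ] (M v k * s)                  ≡⟨ *-distribʳ-sum s (M v) ⟨
  sum (M v) * s                           ≡⟨ cong (_* s) (row v) ⟩
  s * s                                   ∎
  where open ≡-Reasoning

δ : ∀ {n} → Fin n → Fin n → ℤ
δ v u with u ≟ v
... | yes _ = 1ℤ
... | no  _ = 0ℤ

∑-δ : ∀ {n} (v : Fin n) → ∑[ u < n ] δ v u ≡ 1ℤ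
∑-δ {suc n} v = begin
  ∑[ u < suc n ] δ v u                       ≡⟨ sum-remove {i = v} (δ v) ⟩
  δ v v + ∑[ u < n ] δ v (punchIn v u)       ≡⟨ cong₂ _+_ δ-diagonal (sum-cong-≗ (δ-off ∘ punchInᵢ≢i v)) ⟩
  1ℤ + ∑[ u < n ] 0ℤ                         ≡⟨ cong (_+_ 1ℤ) (sum-replicate-zero n) ⟩
  1ℤ                                         ∎
  where
  open ≡-Reasoning
  δ-diagonal : δ v v ≡ 1ℤ
  δ-diagonal with v ≟ v
  ... | yes _   = refl
  ... | no v≢v = contradiction refl v≢v
  δ-off : ∀ {u} → u ≢ v → δ v u ≡ 0ℤ
  δ-off {u} u≢v with u ≟ v
  ... | yes u≡v = contradiction u≡v u≢v
  ... | no  _   = refl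

sum-nonneg : ∀ {n} (f : Fin n → ℤ) → (∀ i → 0ℤ ≤ f i) → 0ℤ ≤ sum f
sum-nonneg {zero}  f f≥0 = ℤ.≤-refl
sum-nonneg {suc n} f f≥0 = ℤ.+-mono-≤ (f≥0 zero) (sum-nonneg (f ∘ suc) (f≥0 ∘ suc))

nonneg-+≡0 : ∀ {i j} → 0ℤ ≤ i → 0ℤ ≤ j → i + j ≡ 0ℤ → i ≡ 0ℤ × j ≡ 0ℤ
nonneg-+≡0 {+ m} {+ k} (+≤+ _) (+≤+ _) m+k≡0 =
  cong +_ (ℕ.m+n≡0⇒m≡0 m (ℤ.+-injective m+k≡0)) , cong +_ (ℕ.m+n≡0⇒n≡0 m (ℤ.+-injective m+k≡0))

sum-nonneg≡0 : ∀ {n} (f : Fin n → ℤ) → (∀ i → 0ℤ ≤ f i) → sum f ≡ 0ℤ → ∀ i → f i ≡ 0ℤ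
sum-nonneg≡0 {suc n} f f≥0 ∑f≡0 i with nonneg-+≡0 (f≥0 zero) (sum-nonneg (f ∘ suc) (f≥0 ∘ suc)) ∑f≡0
sum-nonneg≡0 {suc n} f f≥0 ∑f≡0 zero    | f₀≡0 , _   = f₀≡0
sum-nonneg≡0 {suc n} f f≥0 ∑f≡0 (suc i) | _    , ∑≡0 = sum-nonneg≡0 (f ∘ suc) (f≥0 ∘ suc) ∑≡0 i

-- Enumerating decidable subsets of Fin n

indicator : ∀ {P : Set} → Dec P → ℕ
indicator (yes _) = 1
indicator (no  _) = 0

count : ∀ {n} {P : Fin n → Set} → Decidable P → ℕ
count {n} P? = ∑ℕ n (λ i → indicator (P? i))

record Enumeration {n} (P : Fin n → Set) (m : ℕ) : Set where
  field
    elem           : Fin m → Fin n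
    elem-injective : ∀ {i j} → elem i ≡ elem j → i ≡ j
    elem-sound     : ∀ i → P (elem i)
    elem-complete  : ∀ {x} → P x → ∃ λ i → elem i ≡ x

  index : ∀ {x} → P x → Fin m
  index Px = proj₁ (elem-complete Px)

  elem-index : ∀ {x} (Px : P x) → elem (index Px) ≡ x
  elem-index Px = proj₂ (elem-complete Px)

enumerate : ∀ {n} {P : Fin n → Set} (P? : Decidable P) → Enumeration P (count P?)
enumerate {zero} P? = record
  { elem = λ () ; elem-injective = λ { {()} } ; elem-sound = λ () ; elem-complete = λ { {()} } }
enumerate {suc n} {P} P? with P? zero | enumerate (P? ∘ suc)
... | yes P0 | E = record
  { elem = elem′ ; elem-injective = injective ; elem-sound = sound ; elem-complete = complete }
  where
  open Enumeration E
  elem′ : Fin (suc (count (P? ∘ suc))) → Fin (suc n)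
  elem′ zero    = zero
  elem′ (suc i) = suc (elem i)
  injective : ∀ {i j} → elem′ i ≡ elem′ j → i ≡ j
  injective {zero}  {zero}  _  = refl
  injective {suc i} {suc j} eq = cong suc (elem-injective (suc-injective eq))
  sound : ∀ i → P (elem′ i)
  sound zero    = P0
  sound (suc i) = elem-sound i
  complete : ∀ {x} → P x → ∃ λ i → elem′ i ≡ x
  complete {zero}  _  = zero , refl
  complete {suc x} Px with elem-complete Px
  ... | i , eq = suc i , cong suc eq
... | no ¬P0 | E = record
  { elem = suc ∘ elem
  ; elem-injective = elem-injective ∘ suc-injective
  ; elem-sound = elem-sound
  ; elem-complete = complete }
  where
  open Enumeration E
  complete : ∀ {x} → P x → ∃ λ i → suc (elem i) ≡ x
  complete {zero}  P0 = contradiction P0 ¬P0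
  complete {suc x} Px with elem-complete Px
  ... | i , eq = i , cong suc eq

module _ {n} {P : Fin n → Set} where

  enumeration-insert : ∀ {m v} → ¬ P v → Enumeration P m → Enumeration (λ x → v ≡ x ⊎ P x) (suc m)
  enumeration-insert {m} {v} ¬Pv E = record
    { elem = elem′ ; elem-injective = injective ; elem-sound = sound ; elem-complete = complete }
    where
    open Enumeration E
    elem′ : Fin (suc m) → Fin n
    elem′ zero    = v
    elem′ (suc i) = elem i
    injective : ∀ {i j} → elem′ i ≡ elem′ j → i ≡ j
    injective {zero}  {zero}  _  = refl
    injective {zero}  {suc j} eq = contradiction (subst P (sym eq) (elem-sound j)) ¬Pv
    injective {suc i} {zero}  eq = contradiction (subst P eq (elem-sound i)) ¬Pv
    injective {suc i} {suc j} eq = cong suc (elem-injective eq)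
    sound : ∀ i → v ≡ elem′ i ⊎ P (elem′ i)
    sound zero    = inj₁ refl
    sound (suc i) = inj₂ (elem-sound i)
    complete : ∀ {x} → v ≡ x ⊎ P x → ∃ λ i → elem′ i ≡ x
    complete (inj₁ v≡x) = zero , v≡x
    complete (inj₂ Px)  with elem-complete Px
    ... | i , eq = suc i , eq

  empty-enumeration : ∀ {x} → Enumeration P 0 → ¬ P x
  empty-enumeration E Px with Enumeration.index E Px
  ... | ()

  singleton-unique : ∀ {x y} → Enumeration P 1 → P x → P y → x ≡ y
  singleton-unique E Px Py with elem-complete Px | elem-complete Py
    where open Enumeration E
  ... | zero , refl | zero , refl = refl

  two-distinct : ∀ {m} → Enumeration P (suc (suc m)) → ∃₂ λ x y → P x × P y × x ≢ y
  two-distinct E = elem zero , elem (suc zero) , elem-sound zero , elem-sound (suc zero) , λ eq → 0≢1 (elem-injective eq)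
    where
    open Enumeration E
    0≢1 : ∀ {m} → zero ≢ Fin.suc {suc m} zero
    0≢1 ()

  pair-minus-one-unique : ∀ {x y z} → Enumeration P 2 → P z → P x → P y → x ≢ z → y ≢ z → x ≡ y
  pair-minus-one-unique E Pz Px Py x≢z y≢z with elem-complete Pz | elem-complete Px | elem-complete Py
    where open Enumeration E
  ... | zero     , refl | zero     , refl | _              = contradiction refl x≢z
  ... | zero     , refl | suc zero , refl | zero     , refl = contradiction refl y≢z
  ... | zero     , refl | suc zero , refl | suc zero , refl = refl
  ... | suc zero , refl | suc zero , refl | _              = contradiction refl x≢z
  ... | suc zero , refl | zero     , refl | suc zero , refl = contradiction refl y≢z
  ... | suc zero , refl | zero     , refl | zero     , refl = refl

-- Entries and path defects

_≟ₑ_ : DecidableEquality Entry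
pos ≟ₑ pos = yes refl
pos ≟ₑ neg = no λ ()
pos ≟ₑ non = no λ ()
neg ≟ₑ pos = no λ ()
neg ≟ₑ neg = yes refl
neg ≟ₑ non = no λ ()
non ≟ₑ pos = no λ ()
non ≟ₑ neg = no λ ()
non ≟ₑ non = yes refl

non-entry : ∀ {e} → e ≢ pos → e ≢ neg → e ≡ non
non-entry {pos} e≢pos _ = contradiction refl e≢pos
non-entry {neg} _ e≢neg = contradiction refl e≢neg
non-entry {non} _ _     = refl

isEdge-by-sign : ∀ e → + isEdge e ≡ + indicator (e ≟ₑ pos) + + indicator (e ≟ₑ neg)
isEdge-by-sign pos = refl
isEdge-by-sign neg = refl
isEdge-by-sign non = refl

entryℤ-by-sign : ∀ e → entryℤ e ≡ + indicator (e ≟ₑ pos) - + indicator (e ≟ₑ neg)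
entryℤ-by-sign pos = refl
entryℤ-by-sign neg = refl
entryℤ-by-sign non = refl

-- For vertices v, u: inside means that u = v or u ~ v.
data Side : Set where
  inside outside : Side

sideSign : Side → ℤ
sideSign inside  = -1ℤ
sideSign outside = 1ℤ

pathDefect : Side → Entry → Entry → ℤ
pathDefect s e₁ e₂ = + isEdge e₁ * + isEdge e₂ + sideSign s * (entryℤ e₁ * entryℤ e₂)

pathDefect-nonneg : ∀ s e₁ e₂ → 0ℤ ≤ pathDefect s e₁ e₂
pathDefect-nonneg inside  pos pos = +≤+ ℕ.z≤n
pathDefect-nonneg inside  pos neg = +≤+ ℕ.z≤n
pathDefect-nonneg inside  pos non = +≤+ ℕ.z≤n
pathDefect-nonneg inside  neg pos = +≤+ ℕ.z≤n
pathDefect-nonneg inside  neg neg = +≤+ ℕ.z≤n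
pathDefect-nonneg inside  neg non = +≤+ ℕ.z≤n
pathDefect-nonneg inside  non _   = +≤+ ℕ.z≤n
pathDefect-nonneg outside pos pos = +≤+ ℕ.z≤n
pathDefect-nonneg outside pos neg = +≤+ ℕ.z≤n
pathDefect-nonneg outside pos non = +≤+ ℕ.z≤n
pathDefect-nonneg outside neg pos = +≤+ ℕ.z≤n
pathDefect-nonneg outside neg neg = +≤+ ℕ.z≤n
pathDefect-nonneg outside neg non = +≤+ ℕ.z≤n
pathDefect-nonneg outside non _   = +≤+ ℕ.z≤n

inside-defect-free : ∀ {e₁ e₂} → pathDefect inside e₁ e₂ ≡ 0ℤ → e₁ ≢ non → e₂ ≢ non → e₁ ≡ e₂
inside-defect-free {pos} {pos} _  _      _      = refl
inside-defect-free {neg} {neg} _  _      _      = refl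
inside-defect-free {pos} {neg} ()
inside-defect-free {neg} {pos} ()
inside-defect-free {non}       _  e₁≢non _      = contradiction refl e₁≢non
inside-defect-free {_}   {non} _  _      e₂≢non = contradiction refl e₂≢non

outside-defect-free : ∀ {e₁ e₂} → pathDefect outside e₁ e₂ ≡ 0ℤ → e₁ ≢ non → e₂ ≢ non → e₁ ≢ e₂
outside-defect-free {non} _  e₁≢non _ _    = e₁≢non refl
outside-defect-free {pos} () _      _ refl
outside-defect-free {neg} () _      _ refl

module _ {n} (G : SignedGraph n) where

  |A| : Fin n → Fin n → ℤ
  |A| v u = + isEdge (adj G v u)

  side : Fin n → Fin n → Side
  side v u with u ≟ v | adj G v u
  ... | yes _ | _   = inside
  ... | no  _ | non = outside
  ... | no  _ | pos = inside
  ... | no  _ | neg = inside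

  side-adjacent : ∀ {v u} → Adjacent G v u → side v u ≡ inside
  side-adjacent {v} {u} v~u with u ≟ v | adj G v u
  ... | yes _ | _   = refl
  ... | no  _ | pos = refl
  ... | no  _ | neg = refl
  ... | no  _ | non = contradiction refl v~u

  side-nonadjacent : ∀ {v u} → u ≢ v → adj G v u ≡ non → side v u ≡ outside
  side-nonadjacent {v} {u} u≢v v≁u with u ≟ v | adj G v u
  ... | yes u≡v | _   = contradiction u≡v u≢v
  ... | no  _   | non = refl
  ... | no  _   | pos = contradiction v≁u λ ()
  ... | no  _   | neg = contradiction v≁u λ ()

  pathDefectAt : Fin n → Fin n → Fin n → ℤ
  pathDefectAt v u k = pathDefect (side v u) (adj G v k) (adj G k u)

  edgeIndicator : Entry → Fin n → Fin n → ℤ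
  edgeIndicator s v k = + indicator (adj G v k ≟ₑ s)

  d⁺ d⁻ : Fin n → ℕ
  d⁺ v = count (λ k → adj G v k ≟ₑ pos)
  d⁻ v = count (λ k → adj G v k ≟ₑ neg)

  degree≡d⁺+d⁻ : ∀ v → + degree G v ≡ + d⁺ v + + d⁻ v
  degree≡d⁺+d⁻ v = begin
    + degree G v                                                    ≡⟨ ∑ℕ≡sum n _ ⟩
    ∑[ k < n ] (|A| v k)                                            ≡⟨ sum-cong-≗ (isEdge-by-sign ∘ adj G v) ⟩
    ∑[ k < n ] (edgeIndicator pos v k + edgeIndicator neg v k)      ≡⟨ ∑-distrib-+ (edgeIndicator pos v) (edgeIndicator neg v) ⟩
    sum (edgeIndicator pos v) + sum (edgeIndicator neg v)           ≡⟨ cong₂ _+_ (∑ℕ≡sum n _) (∑ℕ≡sum n _) ⟨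
    + d⁺ v + + d⁻ v                                                 ∎
    where open ≡-Reasoning

  netDegree≡d⁺-d⁻ : ∀ v → netDegree G v ≡ + d⁺ v - + d⁻ v
  netDegree≡d⁺-d⁻ v = begin
    netDegree G v                                                   ≡⟨ ∑≡sum n _ ⟩
    ∑[ k < n ] (A G v k)                                            ≡⟨ sum-cong-≗ (entryℤ-by-sign ∘ adj G v) ⟩
    ∑[ k < n ] (edgeIndicator pos v k - edgeIndicator neg v k)      ≡⟨ ∑-distrib-+ (edgeIndicator pos v) (-_ ∘ edgeIndicator neg v) ⟩
    sum (edgeIndicator pos v) + ∑[ k < n ] (- edgeIndicator neg v k) ≡⟨ cong (_+_ (sum (edgeIndicator pos v))) (∑-neg (edgeIndicator neg v)) ⟩
    sum (edgeIndicator pos v) - sum (edgeIndicator neg v)           ≡⟨ cong₂ _-_ (∑ℕ≡sum n _) (∑ℕ≡sum n _) ⟨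
    + d⁺ v - + d⁻ v                                                 ∎
    where open ≡-Reasoning

module WalkCounts {n} {G : SignedGraph n} {r : ℕ} {a b c ρ : ℤ}
  (srsg : IsSRSG G r a b c) (regular : Regular G r) (netRegular : NetRegular G ρ) where

  open IsSRSG srsg
  open ≡-Reasoning

  row-|A| : ∀ v → ∑[ u < n ] (|A| G v u) ≡ + r
  row-|A| v = trans (sym (∑ℕ≡sum n _)) (cong +_ (regular v))

  row-A : ∀ v → ∑[ u < n ] (A G v u) ≡ ρ
  row-A v = trans (sym (∑≡sum n _)) (netRegular v)

  row-A² : ∀ v → ∑[ u < n ] (A² G v u) ≡ ρ * ρ
  row-A² v = trans (sum-cong-≗ (λ u → ∑≡sum n (λ k → A G v k * A G k u))) (two-step-row-sum (A G) row-A v)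

  -- Equals 2 · A² v u when u = v or u ~ v, and 0 otherwise.
  closedWeight : Fin n → Fin n → ℤ
  closedWeight v u = + 2 * + r * δ v u + ((a - b) * A G v u + (a + b) * |A| G v u)

  closedWeightTotal : ℤ
  closedWeightTotal = + 2 * + r + ((a - b) * ρ + (a + b) * + r)

  row-closedWeight : ∀ v → ∑[ u < n ] (closedWeight v u) ≡ closedWeightTotal
  row-closedWeight v = begin
    ∑[ u < n ] (closedWeight v u)
      ≡⟨ ∑-linear₃ (+ 2 * + r) (a - b) (a + b) (δ v) (A G v) (|A| G v) ⟩
    + 2 * + r * sum (δ v) + ((a - b) * sum (A G v) + (a + b) * sum (|A| G v))
      ≡⟨ cong₂ _+_ (cong (+ 2 * + r *_) (∑-δ v)) (cong₂ _+_ (cong ((a - b) *_) (row-A v)) (cong ((a + b) *_) (row-|A| v))) ⟩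
    + 2 * + r * 1ℤ + ((a - b) * ρ + (a + b) * + r)
      ≡⟨ cong (_+ ((a - b) * ρ + (a + b) * + r)) (ℤ.*-identityʳ (+ 2 * + r)) ⟩
    closedWeightTotal ∎

  A²-split : ∀ v u → A² G v u ≡ closedWeight v u + sideSign (side G v u) * A² G v u
  A²-split v u with u ≟ v
  ... | yes refl rewrite diagonal v | loopless G v = at-self (+ r) a b
    where
    at-self : ∀ x a b → x ≡ + 2 * x * 1ℤ + ((a - b) * 0ℤ + (a + b) * 0ℤ) + -1ℤ * x
    at-self = solve-∀
  ... | no u≢v with adj G v u in e
  ...   | pos rewrite posEdges v u e = at-positive (+ r) a b
    where
    at-positive : ∀ x a b → a ≡ + 2 * x * 0ℤ + ((a - b) * 1ℤ + (a + b) * 1ℤ) + -1ℤ * a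
    at-positive = solve-∀
  ...   | neg rewrite negEdges v u e = at-negative (+ r) a b
    where
    at-negative : ∀ x a b → b ≡ + 2 * x * 0ℤ + ((a - b) * -1ℤ + (a + b) * 1ℤ) + -1ℤ * b
    at-negative = solve-∀
  ...   | non rewrite nonAdjacent v u (u≢v ∘ sym) e = at-outside (+ r) a b c
    where
    at-outside : ∀ x a b c → c ≡ + 2 * x * 0ℤ + ((a - b) * 0ℤ + (a + b) * 0ℤ) + 1ℤ * c
    at-outside = solve-∀

  row-signedA² : ∀ v → ∑[ u < n ] (sideSign (side G v u) * A² G v u) ≡ ρ * ρ - closedWeightTotal
  row-signedA² v = begin
    sum s·A²                           ≡⟨ x≡[y+x]-y (sum s·A²) (sum (closedWeight v)) ⟩
    (sum (closedWeight v) + sum s·A²) - sum (closedWeight v)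
      ≡⟨ cong₂ _-_ (trans (sym (∑-distrib-+ (closedWeight v) s·A²)) (sym (sum-cong-≗ (A²-split v))))
                   (row-closedWeight v) ⟩
    sum (A² G v) - closedWeightTotal   ≡⟨ cong (_- closedWeightTotal) (row-A² v) ⟩
    ρ * ρ - closedWeightTotal          ∎
    where
    s·A² : Fin n → ℤ
    s·A² u = sideSign (side G v u) * A² G v u
    x≡[y+x]-y : ∀ x y → x ≡ (y + x) - y
    x≡[y+x]-y = solve-∀

  row-pathDefect : ∀ v → ∑[ u < n ] ∑[ k < n ] (pathDefectAt G v u k) ≡ + r * + r + (ρ * ρ - closedWeightTotal)
  row-pathDefect v = begin
    ∑[ u < n ] ∑[ k < n ] (pathDefectAt G v u k)
      ≡⟨ sum-cong-≗ split-inner ⟩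
    ∑[ u < n ] (∑[ k < n ] (|A| G v k * |A| G k u) + sideSign (side G v u) * A² G v u)
      ≡⟨ ∑-distrib-+ (λ u → ∑[ k < n ] (|A| G v k * |A| G k u)) (λ u → sideSign (side G v u) * A² G v u) ⟩
    ∑[ u < n ] ∑[ k < n ] (|A| G v k * |A| G k u) + ∑[ u < n ] (sideSign (side G v u) * A² G v u)
      ≡⟨ cong₂ _+_ (two-step-row-sum (|A| G) row-|A| v) (row-signedA² v) ⟩
    + r * + r + (ρ * ρ - closedWeightTotal) ∎
    where
    split-inner : ∀ u → ∑[ k < n ] (pathDefectAt G v u k)
                      ≡ ∑[ k < n ] (|A| G v k * |A| G k u) + sideSign (side G v u) * A² G v u
    split-inner u = begin
      ∑[ k < n ] (pathDefectAt G v u k)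
        ≡⟨ ∑-distrib-+ (λ k → |A| G v k * |A| G k u) (λ k → σ * (A G v k * A G k u)) ⟩
      walks + ∑[ k < n ] (σ * (A G v k * A G k u))
        ≡⟨ cong (_+_ walks) (*-distribˡ-sum σ (λ k → A G v k * A G k u)) ⟨
      walks + σ * sum (λ k → A G v k * A G k u)
        ≡⟨ cong (λ z → walks + σ * z) (∑≡sum n (λ k → A G v k * A G k u)) ⟨
      walks + σ * A² G v u ∎
      where
      σ walks : ℤ
      σ = sideSign (side G v u)
      walks = ∑[ k < n ] (|A| G v k * |A| G k u)

  pathDefect-vanishes : + r * + r + (ρ * ρ - closedWeightTotal) ≡ 0ℤ →
                        ∀ v u k → pathDefectAt G v u k ≡ 0ℤ
  pathDefect-vanishes total≡0 v u = sum-nonneg≡0 (pathDefectAt G v u) defect≥0 (row-sums≡0 u)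
    where
    defect≥0 : ∀ {u} k → 0ℤ ≤ pathDefectAt G v u k
    defect≥0 {u} k = pathDefect-nonneg (side G v u) (adj G v k) (adj G k u)
    row-sums≡0 : ∀ u → ∑[ k < n ] (pathDefectAt G v u k) ≡ 0ℤ
    row-sums≡0 = sum-nonneg≡0 (λ u → ∑[ k < n ] (pathDefectAt G v u k)) (λ u → sum-nonneg _ defect≥0)
                              (trans (row-pathDefect v) total≡0)

-- Sign classes

rook : ∀ {p q} → Fin p × Fin q → Fin p × Fin q → Entry
rook (i , j) (i′ , j′) with does (i ≟ i′) | does (j ≟ j′)
... | false | true  = pos
... | true  | false = neg
... | _     | _     = non

module SignClasses {n} (G : SignedGraph n) (defect-free : ∀ v u k → pathDefectAt G v u k ≡ 0ℤ) where

  triangle-agree : ∀ {v u k} → Adjacent G v u → Adjacent G v k → Adjacent G k u → adj G v k ≡ adj G k u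
  triangle-agree {v} {u} {k} v~u =
    inside-defect-free (subst (λ s → pathDefect s (adj G v k) (adj G k u) ≡ 0ℤ) (side-adjacent G v~u) (defect-free v u k))

  path-disagree : ∀ {v u k} → v ≢ u → adj G v u ≡ non → Adjacent G v k → Adjacent G k u → adj G v k ≢ adj G k u
  path-disagree {v} {u} {k} v≢u v≁u =
    outside-defect-free (subst (λ s → pathDefect s (adj G v k) (adj G k u) ≡ 0ℤ) (side-nonadjacent G (v≢u ∘ sym) v≁u) (defect-free v u k))

  sign-sym : ∀ {x y s} → adj G x y ≡ s → adj G y x ≡ s
  sign-sym {x} {y} = trans (adj-sym G y x)

  adjacent : ∀ {x y s} → s ≢ non → adj G x y ≡ s → Adjacent G x y
  adjacent s≢non xy≡s xy≡non = s≢non (trans (sym xy≡s) xy≡non)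

  clash : ∀ {x y s s′} → adj G x y ≡ s → adj G x y ≡ s′ → s ≢ s′ → ⊥
  clash xy≡s xy≡s′ s≢s′ = s≢s′ (trans (sym xy≡s) xy≡s′)

  same-sign-trans : ∀ {x y z s} → s ≢ non → adj G x y ≡ s → adj G y z ≡ s → x ≢ z → adj G x z ≡ s
  same-sign-trans {x} {y} {z} s≢non xy yz x≢z with adj G x z ≟ₑ non
  ... | yes x≁z = contradiction (trans xy (sym yz)) (path-disagree x≢z x≁z (adjacent s≢non xy) (adjacent s≢non yz))
  ... | no  x~z = trans (triangle-agree (adjacent s≢non xy) x~z (adjacent s≢non (sign-sym yz))) (sign-sym yz)

  opposite-signs-nonadjacent : ∀ {x y z} → adj G x y ≡ pos → adj G y z ≡ neg → adj G x z ≡ non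
  opposite-signs-nonadjacent {x} {y} {z} xy yz with adj G x z ≟ₑ non
  ... | yes x≁z = x≁z
  ... | no  x~z = ⊥-elim (clash xy (trans (triangle-agree x~z (adjacent (λ ()) xy) (adjacent (λ ()) yz)) yz) λ ())

  SameClass : Entry → Fin n → Fin n → Set
  SameClass s x y = x ≡ y ⊎ adj G x y ≡ s

  _≈⁺_ _≈⁻_ : Fin n → Fin n → Set
  _≈⁺_ = SameClass pos
  _≈⁻_ = SameClass neg

  class-sym : ∀ {s x y} → SameClass s x y → SameClass s y x
  class-sym (inj₁ x≡y) = inj₁ (sym x≡y)
  class-sym (inj₂ xy)  = inj₂ (sign-sym xy)

  class-trans : ∀ {s x y z} → s ≢ non → SameClass s x y → SameClass s y z → SameClass s x z
  class-trans _ (inj₁ refl) yz = yz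
  class-trans _ (inj₂ xy) (inj₁ refl) = inj₂ xy
  class-trans {x = x} {z = z} s≢non (inj₂ xy) (inj₂ yz) with x ≟ z
  ... | yes x≡z = inj₁ x≡z
  ... | no  x≢z = inj₂ (same-sign-trans s≢non xy yz x≢z)

  ≈⁺-trans : ∀ {x y z} → x ≈⁺ y → y ≈⁺ z → x ≈⁺ z
  ≈⁺-trans = class-trans λ ()

  ≈⁻-trans : ∀ {x y z} → x ≈⁻ y → y ≈⁻ z → x ≈⁻ z
  ≈⁻-trans = class-trans λ ()

  classes-disjoint : ∀ {x y} → x ≈⁺ y → x ≈⁻ y → x ≡ y
  classes-disjoint (inj₁ x≡y) _          = x≡y
  classes-disjoint (inj₂ _)   (inj₁ x≡y) = x≡y
  classes-disjoint (inj₂ xy)  (inj₂ xy′) = ⊥-elim (clash xy xy′ λ ())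

  meet-unique : ∀ {x y z z′} → x ≈⁺ z → z ≈⁻ y → x ≈⁺ z′ → z′ ≈⁻ y → z ≡ z′
  meet-unique xz zy xz′ z′y = classes-disjoint (≈⁺-trans (class-sym xz) xz′) (≈⁻-trans zy (class-sym z′y))

  Mixed : Fin n → Fin n → Fin n → Set
  Mixed x y k = (adj G x k ≡ pos × adj G k y ≡ neg) ⊎ (adj G x k ≡ neg × adj G k y ≡ pos)

  mixed? : ∀ x y → Decidable (Mixed x y)
  mixed? x y k = ((adj G x k ≟ₑ pos) ×-dec (adj G k y ≟ₑ neg)) ⊎-dec ((adj G x k ≟ₑ neg) ×-dec (adj G k y ≟ₑ pos))

  A²-nonadjacent : ∀ {x y} → x ≢ y → adj G x y ≡ non → A² G x y ≡ - + count (mixed? x y)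
  A²-nonadjacent {x} {y} x≢y x≁y = begin
    A² G x y                                         ≡⟨ ∑≡sum n _ ⟩
    ∑[ k < n ] (A G x k * A G k y)                   ≡⟨ sum-cong-≗ term ⟩
    ∑[ k < n ] (- is-mixed k)                        ≡⟨ ∑-neg is-mixed ⟩
    - sum is-mixed                                   ≡⟨ cong -_ (∑ℕ≡sum n _) ⟨
    - + count (mixed? x y)                           ∎
    where
    open ≡-Reasoning
    is-mixed : Fin n → ℤ
    is-mixed k = + indicator (mixed? x y k)
    same-sign : ∀ {k s} → s ≢ non → adj G x k ≡ s → adj G k y ≡ s → ⊥
    same-sign s≢non xk ky = contradiction (trans xk (sym ky)) (path-disagree x≢y x≁y (adjacent s≢non xk) (adjacent s≢non ky))
    term : ∀ k → A G x k * A G k y ≡ - is-mixed k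
    term k with adj G x k in xk | adj G k y in ky
    ... | pos | pos = ⊥-elim (same-sign (λ ()) xk ky)
    ... | neg | neg = ⊥-elim (same-sign (λ ()) xk ky)
    ... | pos | neg = refl
    ... | neg | pos = refl
    ... | non | _   = refl
    ... | pos | non = refl
    ... | neg | non = refl

  module Rook (pos-neg-route : ∀ {x y} → x ≢ y → adj G x y ≡ non → ∃ λ k → adj G x k ≡ pos × adj G k y ≡ neg) where

    meet : ∀ x y → ∃ λ z → x ≈⁺ z × z ≈⁻ y
    meet x y with x ≟ y | adj G x y in xy
    ... | yes x≡y | _   = x , inj₁ refl , inj₁ x≡y
    ... | no  _   | pos = y , inj₂ xy , inj₁ refl
    ... | no  _   | neg = x , inj₁ refl , inj₂ xy
    ... | no  x≢y | non with pos-neg-route x≢y xy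
    ...   | k , xk , ky = k , inj₂ xk , inj₂ ky

    module Grid {p q} (v : Fin n) (K : Enumeration (v ≈⁺_) p) (T : Enumeration (v ≈⁻_) q) where
      private
        module K = Enumeration K
        module T = Enumeration T

      row : Fin n → Fin p
      row x = K.index (proj₁ (proj₂ (meet v x)))

      row-spec : ∀ x → K.elem (row x) ≈⁻ x
      row-spec x = subst (_≈⁻ x) (sym (K.elem-index _)) (proj₂ (proj₂ (meet v x)))

      row-unique : ∀ {x i} → K.elem i ≈⁻ x → row x ≡ i
      row-unique {x} {i} ix = K.elem-injective
        (meet-unique (K.elem-sound (row x)) (row-spec x) (K.elem-sound i) ix)

      col : Fin n → Fin q
      col x = T.index (class-sym (proj₂ (proj₂ (meet x v))))

      col-spec : ∀ x → T.elem (col x) ≈⁺ x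
      col-spec x = subst (_≈⁺ x) (sym (T.elem-index _)) (class-sym (proj₁ (proj₂ (meet x v))))

      col-unique : ∀ {x j} → T.elem j ≈⁺ x → col x ≡ j
      col-unique {x} {j} jx = T.elem-injective
        (sym (meet-unique (class-sym jx) (class-sym (T.elem-sound j)) (class-sym (col-spec x)) (class-sym (T.elem-sound (col x)))))

      same-row⇒≈⁻ : ∀ {x y} → row x ≡ row y → x ≈⁻ y
      same-row⇒≈⁻ {x} {y} eq = ≈⁻-trans (class-sym (row-spec x)) (subst (λ i → K.elem i ≈⁻ y) (sym eq) (row-spec y))

      same-col⇒≈⁺ : ∀ {x y} → col x ≡ col y → x ≈⁺ y
      same-col⇒≈⁺ {x} {y} eq = ≈⁺-trans (class-sym (col-spec x)) (subst (λ j → T.elem j ≈⁺ y) (sym eq) (col-spec y))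

      ≈⁻⇒same-row : ∀ {x y} → x ≈⁻ y → row x ≡ row y
      ≈⁻⇒same-row {x} {y} xy = sym (row-unique (≈⁻-trans (row-spec x) xy))

      ≈⁺⇒same-col : ∀ {x y} → x ≈⁺ y → col x ≡ col y
      ≈⁺⇒same-col {x} {y} xy = sym (col-unique (≈⁺-trans (col-spec x) xy))

      to : Fin n → Fin p × Fin q
      to x = row x , col x

      from : Fin p × Fin q → Fin n
      from (i , j) = proj₁ (meet (T.elem j) (K.elem i))

      to-from : ∀ ij → to (from ij) ≡ ij
      to-from (i , j) with meet (T.elem j) (K.elem i)
      ... | z , jz , zi = cong₂ _,_ (row-unique (class-sym zi)) (col-unique jz)

      from-to : ∀ x → from (to x) ≡ x
      from-to x with meet (T.elem (col x)) (K.elem (row x))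
      ... | z , jz , zi = classes-disjoint (≈⁺-trans (class-sym jz) (col-spec x)) (≈⁻-trans zi (row-spec x))

      grid : Fin n ↔ (Fin p × Fin q)
      grid = mk↔ₛ′ to from to-from from-to

      adj≡rook : ∀ x y → adj G x y ≡ rook (to x) (to y)
      adj≡rook x y with row x ≟ row y | col x ≟ col y
      ... | yes same-row | yes same-col =
        trans (cong (adj G x) (sym (classes-disjoint (same-col⇒≈⁺ same-col) (same-row⇒≈⁻ same-row)))) (loopless G x)
      ... | no rows≢ | yes same-col with same-col⇒≈⁺ same-col
      ...   | inj₁ x≡y = contradiction (cong row x≡y) rows≢
      ...   | inj₂ xy  = xy
      adj≡rook x y | yes same-row | no cols≢ with same-row⇒≈⁻ same-row
      ...   | inj₁ x≡y = contradiction (cong col x≡y) cols≢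
      ...   | inj₂ xy  = xy
      adj≡rook x y | no rows≢ | no cols≢ with adj G x y in xy
      ...   | pos = contradiction (≈⁺⇒same-col (inj₂ xy)) cols≢
      ...   | neg = contradiction (≈⁻⇒same-row (inj₂ xy)) rows≢
      ...   | non = refl

-- The parameters (5, 2, 1) with net-degree 1

sum5-difference1 : ∀ p q → + p + + q ≡ + 5 → + p - + q ≡ 1ℤ → p ≡ 3 × q ≡ 2
sum5-difference1 0 _ refl ()
sum5-difference1 1 _ refl ()
sum5-difference1 2 _ refl ()
sum5-difference1 3 _ refl _ = refl , refl
sum5-difference1 4 _ refl ()
sum5-difference1 5 _ refl ()
sum5-difference1 (suc (suc (suc (suc (suc (suc _)))))) _ () _

module Parameters-5-2-1 {n} {G : SignedGraph n} {c : ℤ}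
  (srsg : IsSRSG G 5 (+ 2) (+ 1) c) (regular : Regular G 5) (netRegular : NetRegular G (+ 1)) where

  open IsSRSG srsg
  open WalkCounts srsg regular netRegular using (pathDefect-vanishes)

  opaque
    defect-free : ∀ v u k → pathDefectAt G v u k ≡ 0ℤ
    defect-free = pathDefect-vanishes refl

  open SignClasses G defect-free public

  degrees : ∀ v → d⁺ G v ≡ 3 × d⁻ G v ≡ 2
  degrees v = sum5-difference1 (d⁺ G v) (d⁻ G v)
    (trans (sym (degree≡d⁺+d⁻ G v)) (cong +_ (regular v)))
    (trans (sym (netDegree≡d⁺-d⁻ G v)) (netRegular v))

  positive-neighbours : ∀ v → Enumeration (λ k → adj G v k ≡ pos) 3
  positive-neighbours v = subst (Enumeration _) (proj₁ (degrees v)) (enumerate _)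

  negative-neighbours : ∀ v → Enumeration (λ k → adj G v k ≡ neg) 2
  negative-neighbours v = subst (Enumeration _) (proj₂ (degrees v)) (enumerate _)

  positive-class : ∀ v → Enumeration (v ≈⁺_) 4
  positive-class v = enumeration-insert (λ loop → clash loop (loopless G v) λ ()) (positive-neighbours v)

  negative-class : ∀ v → Enumeration (v ≈⁻_) 3
  negative-class v = enumeration-insert (λ loop → clash loop (loopless G v) λ ()) (negative-neighbours v)

  mixed-neighbours : ∀ {x y} → x ≢ y → adj G x y ≡ non → ∃ λ m → c ≡ - + m × Enumeration (Mixed x y) m
  mixed-neighbours x≢y x≁y =
    count (mixed? _ _) , trans (sym (nonAdjacent _ _ x≢y x≁y)) (A²-nonadjacent x≢y x≁y) , enumerate (mixed? _ _)

  mixed-neighbours-of-size : ∀ {x y} → x ≢ y → adj G x y ≡ non → ∀ {m} → c ≡ - + m → Enumeration (Mixed x y) m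
  mixed-neighbours-of-size x≢y x≁y c≡-m with mixed-neighbours x≢y x≁y
  ... | _ , c≡-m′ , E = subst (Enumeration _) (ℤ.+-injective (ℤ.neg-injective (trans (sym c≡-m′) c≡-m))) E

  corner : ∀ v → ∃₂ λ a d → adj G v a ≡ pos × adj G v d ≡ neg
  corner v = P.elem zero , N.elem zero , P.elem-sound zero , N.elem-sound zero
    where
    module P = Enumeration (positive-neighbours v)
    module N = Enumeration (negative-neighbours v)

  module Corner {v a d} (va : adj G v a ≡ pos) (vd : adj G v d ≡ neg) where

    a≁d : adj G a d ≡ non
    a≁d = opposite-signs-nonadjacent (sign-sym va) vd

    a≢d : a ≢ d
    a≢d refl = clash va vd λ ()

    v-mixed : Mixed a d v
    v-mixed = inj₁ (sign-sym va , vd)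

  c≢0 : Fin n → c ≢ 0ℤ
  c≢0 v c≡0 with corner v
  ... | _ , _ , va , vd = empty-enumeration (mixed-neighbours-of-size a≢d a≁d c≡0) v-mixed
    where open Corner va vd

  module UniqueMixed (c≡-1 : c ≡ -1ℤ) {v a d} (va : adj G v a ≡ pos) (vd : adj G v d ≡ neg) where
    open Corner va vd

    mixed-unique : ∀ {x y k k′} → x ≢ y → adj G x y ≡ non → Mixed x y k → Mixed x y k′ → k ≡ k′
    mixed-unique x≢y x≁y = singleton-unique (mixed-neighbours-of-size x≢y x≁y {1} c≡-1)

    some-mixed : ∀ {x y} → x ≢ y → adj G x y ≡ non → ∃ (Mixed x y)
    some-mixed x≢y x≁y = elem zero , elem-sound zero
      where open Enumeration (mixed-neighbours-of-size x≢y x≁y {1} c≡-1)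

    negative-neighbour-of-a : ∀ {x} → adj G a x ≡ neg → x ≢ d × adj G x d ≡ non
    negative-neighbour-of-a {x} ax with adj G x d ≟ₑ pos | adj G x d ≟ₑ neg
    ... | yes xd | _ = ⊥-elim (clash (subst (λ z → adj G a z ≡ pos) v≡x (sign-sym va)) ax λ ())
      where
      v≡x : v ≡ x
      v≡x = mixed-unique a≢d a≁d v-mixed (inj₂ (ax , xd))
    ... | no _ | yes xd = ⊥-elim (clash (same-sign-trans (λ ()) ax xd a≢d) a≁d λ ())
    ... | no x≁⁺d | no x≁⁻d = x≢d , non-entry x≁⁺d x≁⁻d
      where
      x≢d : x ≢ d
      x≢d refl = clash ax a≁d λ ()

    detour : ∀ {x} → adj G a x ≡ neg → ∃ λ k → adj G x k ≡ pos × adj G k d ≡ neg × k ≢ v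
    detour {x} ax with negative-neighbour-of-a ax
    ... | x≢d , x≁d with some-mixed x≢d x≁d
    ...   | k , inj₁ (xk , kd) = k , xk , kd , k≢v
      where
      x≢a : x ≢ a
      x≢a refl = clash ax (loopless G x) λ ()
      k≢v : k ≢ v
      k≢v refl = clash (same-sign-trans (λ ()) xk va x≢a) (sign-sym ax) λ ()
    ...   | k , inj₂ (xk , kd) with ≈⁻-trans (inj₂ ax) (inj₂ xk)
    ...     | inj₁ refl = ⊥-elim (clash kd a≁d λ ())
    ...     | inj₂ ak   = ⊥-elim (clash (subst (λ z → adj G z d ≡ pos) (sym v≡k) kd) vd λ ())
      where
      v≡k : v ≡ k
      v≡k = mixed-unique a≢d a≁d v-mixed (inj₂ (ak , kd))

    -- The two negative neighbours of a would have to be joined positively through the only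
    -- negative neighbour of d other than v.
    absurd : ⊥
    absurd with two-distinct (negative-neighbours a)
    ... | x₁ , x₂ , ax₁ , ax₂ , x₁≢x₂ with detour ax₁ | detour ax₂
    ...   | k₁ , x₁k₁ , k₁d , k₁≢v | k₂ , x₂k₂ , k₂d , k₂≢v = clash x₁x₂-pos x₁x₂-neg λ ()
      where
      k₂≡k₁ : k₂ ≡ k₁
      k₂≡k₁ = pair-minus-one-unique (negative-neighbours d) (sign-sym vd) (sign-sym k₂d) (sign-sym k₁d) k₂≢v k₁≢v
      x₁x₂-pos : adj G x₁ x₂ ≡ pos
      x₁x₂-pos = same-sign-trans (λ ()) x₁k₁ (sign-sym (subst (λ z → adj G x₂ z ≡ pos) k₂≡k₁ x₂k₂)) x₁≢x₂
      x₁x₂-neg : adj G x₁ x₂ ≡ neg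
      x₁x₂-neg = same-sign-trans (λ ()) (sign-sym ax₁) ax₂ x₁≢x₂

  c≢-1 : Fin n → c ≢ -1ℤ
  c≢-1 v c≡-1 with corner v
  ... | _ , _ , va , vd = UniqueMixed.absurd c≡-1 va vd

  pos-neg-route : ∀ {x y} → x ≢ y → adj G x y ≡ non → ∃ λ k → adj G x k ≡ pos × adj G k y ≡ neg
  pos-neg-route {x} {y} x≢y x≁y with mixed-neighbours x≢y x≁y
  ... | zero , c≡0 , _ = contradiction c≡0 (c≢0 x)
  ... | suc zero , c≡-1 , _ = contradiction c≡-1 (c≢-1 x)
  ... | suc (suc _) , _ , E with two-distinct E
  ...   | k , _  , inj₁ route , _ , _ = k , route
  ...   | _ , k′ , inj₂ _ , inj₁ route′ , _ = k′ , route′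
  ...   | k , k′ , inj₂ (xk , ky) , inj₂ (xk′ , k′y) , k≢k′ =
    contradiction (meet-unique (inj₂ (sign-sym ky)) (inj₂ (sign-sym xk)) (inj₂ (sign-sym k′y)) (inj₂ (sign-sym xk′))) k≢k′

  open Rook pos-neg-route public

S₁₂-entry≡rook : ∀ (x y : Fin 4 × Fin 3) → S₁₂-entry x y ≡ rook x y
S₁₂-entry≡rook (i , j) (i′ , j′) with does (i ≟ i′) | does (j ≟ j′)
... | true  | true  = refl
... | true  | false = refl
... | false | true  = refl
... | false | false = refl

S₁₂≡rook : ∀ (x y : Fin 4 × Fin 3) → S₁₂ (uncurry combine x) (uncurry combine y) ≡ rook x y
S₁₂≡rook (i , j) (i′ , j′) =
  trans (cong₂ S₁₂-entry (remQuot-combine i j) (remQuot-combine i′ j′)) (S₁₂-entry≡rook (i , j) (i′ , j′))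

lemma3p5 : ∀ (n : ℕ) (G : SignedGraph n) (c : ℤ) →
    IsSRSG G 5 (+ 2) (+ 1) c →
    InC₁ G (+ 2) (+ 1) c ⊎ InC₄ G (+ 2) (+ 1) c ⊎ InC₅ G (+ 2) (+ 1) c →
    Connected G → ¬ Complete G → Regular G 5 → NetRegular G (+ 1) →
    G ≅ S₁₂
lemma3p5 zero    G c srsg _ _ _ _       _          = ⊥-elim (IsSRSG.notEdgeless srsg λ ())
lemma3p5 (suc _) G c srsg _ _ _ regular netRegular =
  ↔⇒⤖ (↔-sym *↔× ↔-∘ grid) , λ x y → trans (adj≡rook x y) (sym (S₁₂≡rook (to x) (to y)))
  where
  open Parameters-5-2-1 srsg regular netRegular
  open Grid zero (positive-class zero) (negative-class zero)
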